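{- Let $(G,\omega)$, $v_0$ and $u_{\max}$ be as in the context. If $v_0=u_{\max}$, then for every vertex $u\in V(G)\setminus\{v_0\}$, $\mathrm{ecc}_{(G,\omega)}(u)=d(u,v_0)+\omega(v_0)$.
   Context: Graphs are finite, simple, undirected, connected; $d$ is shortest-path distance; $\log$ is the natural logarithm. A graph is median if for every triple of distinct vertices $x,y,z$, $I(x,y)\cap I(y,z)\cap I(z,x)$ is a single vertex, where $I(u,v)=\{x:d(u,x)+d(x,v)=d(u,v)\}$. $\Theta$-classes: edges $uv,xy$ are $\Theta_0$-related if $uvyx$ is a 4-cycle with $uv,xy$ opposite; $\Theta$ is the reflexive-transitive closure; removing a $\Theta$-class leaves two components, its halfspaces. For $\omega:V\to\mathbb{N}$, $d_\omega(u,v)=d(u,v)+\omega(v)$ and $\mathrm{ecc}_{(G,\omega)}(u)=\max_v d_\omega(u,v)$. Setting: $(G,\omega)$ is a weighted median graph with $n=|V(G)|\ge3$ in which every $\Theta$-class has a halfspace (its minority halfspace) of size $<n/(2\log n)$; $v_0$ is the unique vertex belonging to every majority (larger) halfspace. $u_{\max}$ is a vertex maximizing $d_\omega(v_0,\cdot)$, chosen equal to $v_0$ whenever $v_0$ is a maximizer. -}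

module Defs where

open import Data.Nat using (ℕ; zero; suc; _+_; _*_; _^_; _<_; _≤_; _⊔_; _!)

open import Data.Fin using (Fin)
open import Data.Fin.Subset using (Subset; _∈_; ∣_∣)
open import Data.List using (List; foldr; map; allFin)
open import Data.Product using (Σ; ∃; _×_; _,_)
open import Data.Sum using (_⊎_)
open import Data.Empty using (⊥)
open import Relation.Nullary using (¬_)
open import Relation.Binary.PropositionalEquality using (_≡_)
open import Relation.Binary.Construct.Closure.ReflexiveTransitive using (Star)
open import Function using (_⇔_)

module _ {n : ℕ} where

  Rel : Set₁
  Rel = Fin n → Fin n → Set

  IsSimpleGraph : Rel → Set
  IsSimpleGraph adj = (∀ u v → adj u v → adj v u) × (∀ u → ¬ adj u u)

  data Walk (E : Rel) : Fin n → Fin n → ℕ → Set where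
    nil  : ∀ {u} → Walk E u u 0
    cons : ∀ {u w v k} → E u w → Walk E w v k → Walk E u v (suc k)

  Connected : Rel → Set
  Connected adj = ∀ u v → ∃ λ k → Walk adj u v k

  IsShortestPathDist : Rel → (Fin n → Fin n → ℕ) → Set
  IsShortestPathDist adj d =
    ∀ u v → Walk adj u v (d u v) × (∀ k → Walk adj u v k → d u v ≤ k)

  InInterval : (Fin n → Fin n → ℕ) → Fin n → Fin n → Fin n → Set
  InInterval d u v x = d u x + d x v ≡ d u v

  IsMedian : (Fin n → Fin n → ℕ) → Set
  IsMedian d = ∀ x y z → ¬ x ≡ y → ¬ y ≡ z → ¬ x ≡ z →
    Σ (Fin n) λ m →
      (InInterval d x y m × InInterval d y z m × InInterval d z x m) ×
      (∀ m' → InInterval d x y m' → InInterval d y z m' → InInterval d z x m' → m' ≡ m)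

  Edge : Set
  Edge = Fin n × Fin n

  FourCycle : Rel → Fin n → Fin n → Fin n → Fin n → Set
  FourCycle adj u v y x =
    adj u v × adj v y × adj y x × adj x u ×
    ¬ u ≡ v × ¬ u ≡ y × ¬ u ≡ x × ¬ v ≡ y × ¬ v ≡ x × ¬ y ≡ x

  -- generating relation of Θ on oriented edges: reversal of an edge
  -- (edges are unordered) and Θ₀ (opposite edges of a 4-cycle)
  data Θstep (adj : Rel) : Edge → Edge → Set where
    flip   : ∀ {u v} → adj u v → Θstep adj (u , v) (v , u)
    square : ∀ {u v x y} → FourCycle adj u v y x → Θstep adj (u , v) (x , y)

  Θ : Rel → Edge → Edge → Set
  Θ adj = Star (Θstep adj)

  AdjMinusClass : Rel → Fin n → Fin n → Rel
  AdjMinusClass adj a b u w = adj u w × ¬ Θ adj (u , w) (a , b)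

  IsComponentMinusClass : Rel → Fin n → Fin n → Fin n → Subset n → Set
  IsComponentMinusClass adj a b x S =
    ∀ y → (y ∈ S) ⇔ (∃ λ k → Walk (AdjMinusClass adj a b) x y k)

  ecc : (Fin n → Fin n → ℕ) → (Fin n → ℕ) → Fin n → ℕ
  ecc d ω u = foldr _⊔_ 0 (map (λ v → d u v + ω v) (allFin n))

-- expNum x N = N! * Σ_{j=0}^{N} x^j / j!   (a natural number)
expNum : ℕ → ℕ → ℕ
expNum x zero = 1
expNum x (suc N) = suc N * expNum x N + x ^ suc N

-- SmallHalf m k  ⇔  k < m / (2 log m)  (for m ≥ 2), via
--   k < m/(2 ln m) ⇔ 2k ln m < m ⇔ m^(2k) < e^m
--   ⇔ ∃ N, m^(2k) < Σ_{j≤N} m^j / j!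
SmallHalf : ℕ → ℕ → Set
SmallHalf m k = ∃ λ N → m ^ (2 * k) * (N !) < expNum m N

-- The triangle inequality through v₀ gives d(u,v) + ω(v) ≤ d(u,v₀) + d_ω(v₀,v), and
-- d_ω(v₀,v) ≤ d_ω(v₀,v₀) = ω(v₀) because v₀ is a maximizer. So every term in the
-- eccentricity of u is at most d(u,v₀) + ω(v₀), a value attained at v = v₀.
module Submission where

open import Defs
open import Data.Nat using (ℕ; _+_; _≤_; _<_; _⊔_; z≤n)
open import Data.Nat.Properties
open import Data.Fin using (Fin)
open import Data.Fin.Subset using (Subset; _∈_; ∣_∣)
open import Data.List using (allFin)
open import Data.List.Properties using (foldr-preservesᵇ; foldr-preservesᵒ)
open import Data.List.Relation.Unary.All as All using ()
open import Data.List.Relation.Unary.All.Properties as All using ()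
open import Data.List.Relation.Unary.Any as Any using ()
open import Data.List.Membership.Propositional.Properties using (∈-allFin; ∈-map⁺)
open import Data.Product using (Σ; _×_; proj₁; proj₂)
open import Data.Sum using (_⊎_; inj₁; inj₂)
open import Relation.Nullary using (¬_)
open import Relation.Binary.PropositionalEquality using (_≡_; cong)

module _ {n : ℕ} {E : Rel {n}} where

  _++ʷ_ : ∀ {a b c j k} → Walk E a b j → Walk E b c k → Walk E a c (j + k)
  nil      ++ʷ q = q
  cons e p ++ʷ q = cons e (p ++ʷ q)

module ShortestPathDist {n : ℕ} {adj : Rel {n}} {d : Fin n → Fin n → ℕ}
                        (isDist : IsShortestPathDist adj d) where

  d-refl : ∀ u → d u u ≡ 0
  d-refl u = n≤0⇒n≡0 (proj₂ (isDist u u) 0 nil)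

  d-triangle : ∀ u v w → d u w ≤ d u v + d v w
  d-triangle u v w = proj₂ (isDist u w) _ (proj₁ (isDist u v) ++ʷ proj₁ (isDist v w))

module _ {n : ℕ} (d : Fin n → Fin n → ℕ) (ω : Fin n → ℕ) where

  ecc-lub : ∀ u M → (∀ v → d u v + ω v ≤ M) → ecc d ω u ≤ M
  ecc-lub u M bound = foldr-preservesᵇ {P = _≤ M} ⊔-lub z≤n
    (All.map⁺ {xs = allFin n} (All.tabulate λ {v} _ → bound v))

  d+ω≤ecc : ∀ u v → d u v + ω v ≤ ecc d ω u
  d+ω≤ecc u v = foldr-preservesᵒ {P = d u v + ω v ≤_} ≤-⊔ 0 _
    (inj₂ (Any.map ≤-reflexive (∈-map⁺ _ (∈-allFin v))))
    where
    ≤-⊔ : ∀ x y → (d u v + ω v ≤ x) ⊎ (d u v + ω v ≤ y) → d u v + ω v ≤ x ⊔ y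
    ≤-⊔ x y (inj₁ p) = m≤n⇒m≤n⊔o y p
    ≤-⊔ x y (inj₂ p) = m≤n⇒m≤o⊔n x p

  ecc-attained : ∀ u w → (∀ v → d u v + ω v ≤ d u w + ω w) → ecc d ω u ≡ d u w + ω w
  ecc-attained u w bound = ≤-antisym (ecc-lub u _ bound) (d+ω≤ecc u w)

ecc-from-maximizer : ∀ {n} {adj : Rel {n}} {d : Fin n → Fin n → ℕ} → IsShortestPathDist adj d →
  (ω : Fin n → ℕ) (v₀ : Fin n) → (∀ v → d v₀ v + ω v ≤ d v₀ v₀ + ω v₀) →
  ∀ u → ecc d ω u ≡ d u v₀ + ω v₀
ecc-from-maximizer {d = d} isDist ω v₀ v₀-max u = ecc-attained d ω u v₀ bound
  where
  open ShortestPathDist isDist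
  open ≤-Reasoning

  bound : ∀ v → d u v + ω v ≤ d u v₀ + ω v₀
  bound v = begin
    d u v + ω v                  ≤⟨ +-monoˡ-≤ (ω v) (d-triangle u v₀ v) ⟩
    d u v₀ + d v₀ v + ω v        ≡⟨ +-assoc (d u v₀) (d v₀ v) (ω v) ⟩
    d u v₀ + (d v₀ v + ω v)      ≤⟨ +-monoʳ-≤ (d u v₀) (v₀-max v) ⟩
    d u v₀ + (d v₀ v₀ + ω v₀)    ≡⟨ cong (λ x → d u v₀ + (x + ω v₀)) (d-refl v₀) ⟩
    d u v₀ + ω v₀                ∎

lemma18 : (n : ℕ) → 3 ≤ n →
  (adj : Fin n → Fin n → Set) → IsSimpleGraph adj → Connected adj →
  (d : Fin n → Fin n → ℕ) → IsShortestPathDist adj d →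
  IsMedian d →
  (ω : Fin n → ℕ) →
  (∀ a b → adj a b →
    Σ (Subset n) λ S →
      (IsComponentMinusClass adj a b a S ⊎ IsComponentMinusClass adj a b b S) ×
      SmallHalf n ∣ S ∣) →
  (v₀ : Fin n) →
  (∀ a b → adj a b → (Sa Sb : Subset n) →
    IsComponentMinusClass adj a b a Sa → IsComponentMinusClass adj a b b Sb →
    ∣ Sa ∣ < ∣ Sb ∣ → v₀ ∈ Sb) →
  (∀ v → d v₀ v + ω v ≤ d v₀ v₀ + ω v₀) →
  ∀ u → ¬ u ≡ v₀ → ecc d ω u ≡ d u v₀ + ω v₀
lemma18 _ _ _ _ _ _ isDist _ ω _ v₀ _ v₀-max u _ = ecc-from-maximizer isDist ω v₀ v₀-max u
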